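{- Let $a\in\mathbb C\setminus\{0\}$ and $b\in\mathbb C$. Then (a) $\{\widehat{\mathcal B}(a,b)_n:n\ge0\}$ is a generating set of the algebra $\mathsf{NSym}$, and (b) $\{\mathrm{comm}(\widehat{\mathcal B}(a,b)_n):n\ge0\}$ is a generating set of the algebra $\mathsf{Sym}$.
   Context: $\mathsf{NSym}$ is the algebra of noncommutative symmetric functions over $\mathbb C$: free associative on $H_1,H_2,\dots$, with $H_\beta=H_{\beta_1}\cdots H_{\beta_l}$ for a composition $\beta$ of length $\ell(\beta)=l$. $\mathsf{Sym}$ is the algebra of symmetric functions over $\mathbb C$, $h_n$ the complete homogeneous symmetric functions, and $\mathrm{comm}:\mathsf{NSym}\to\mathsf{Sym}$ the algebra homomorphism with $H_n\mapsto h_n$. For $n\ge1$, $\widehat{\mathcal B}(a,b)_n=\sum_{\beta}a^{n-\ell(\beta)}b^{\ell(\beta)-1}H_\beta$, the sum over all compositions $\beta$ of $n$ (with $0^0=1$); $\widehat{\mathcal B}(a,b)_0=1$. (Equivalently, $\widehat{\mathcal B}(a,b)_n$ is the specialization at $q=a,t=b$ of $\sum_{J\subseteq[n-1]}q^{n-1-|J|}t^{|J|}H_{\mathrm{comp}(J)}$.) -}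

module Defs where

open import Level using (Level; _⊔_)
open import Algebra.Bundles using (CommutativeRing)
open import Data.Nat as ℕ using (ℕ; zero; suc; _∸_)
import Data.Nat.Properties as ℕP
open import Data.List using (List; []; _∷_; _++_; length; map; concatMap; foldr)
open import Data.List.Properties using (≡-dec)
open import Data.List.Sort.InsertionSort ℕP.≤-decTotalOrder using (sort)
open import Data.Product using (Σ; ∃; _×_; _,_)
open import Relation.Nullary using (¬_; yes; no)
open import Relation.Binary.PropositionalEquality using (_≡_)

-- A composition of m+2 arises from a unique composition of m+1 either by
-- prepending a part 1 or by increasing its first part by 1.

bump : List ℕ → List ℕ
bump []      = []
bump (k ∷ β) = suc k ∷ β

comps : ℕ → List (List ℕ)
comps zero          = [] ∷ []
comps (suc zero)    = (1 ∷ []) ∷ []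
comps (suc (suc m)) = concatMap (λ β → (1 ∷ β) ∷ bump β ∷ []) (comps (suc m))

-- Words in the letters H_1, H_2, ... : the letter k encodes H_{k+1}.
Word : Set
Word = List ℕ

module _ {c ℓ : Level} (K : CommutativeRing c ℓ) where
  open CommutativeRing K

  IsField : Set (c ⊔ ℓ)
  IsField = (¬ (0# ≈ 1#)) × (∀ x → ¬ (x ≈ 0#) → ∃ λ y → x * y ≈ 1#)

  infixr 8 _^ᴷ_
  _^ᴷ_ : Carrier → ℕ → Carrier
  x ^ᴷ zero  = 1#
  x ^ᴷ suc n = x * (x ^ᴷ n)

  -- NSym over K: the free associative K-algebra on H_1, H_2, ...
  -- An element is a finite formal K-linear combination of words;
  -- two elements are equal iff all their coefficients agree.

  NSym : Set c
  NSym = List (Carrier × Word)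

  coeffN : NSym → Word → Carrier
  coeffN []             w = 0#
  coeffN ((x , u) ∷ f)  w with ≡-dec ℕ._≟_ u w
  ... | yes _ = x + coeffN f w
  ... | no  _ = coeffN f w

  _≈N_ : NSym → NSym → Set ℓ
  f ≈N g = ∀ w → coeffN f w ≈ coeffN g w

  oneN : NSym
  oneN = (1# , []) ∷ []

  _+N_ : NSym → NSym → NSym
  f +N g = f ++ g

  _*N_ : NSym → NSym → NSym
  f *N g = concatMap (λ { (x , u) → map (λ { (y , v) → (x * y , u ++ v) }) g }) f

  scaleN : Carrier → NSym → NSym
  scaleN x f = map (λ { (y , v) → (x * y , v) }) f

  H : ℕ → NSym
  H zero    = oneN
  H (suc k) = (1# , k ∷ []) ∷ []

  Hc : List ℕ → NSym
  Hc β = foldr (λ k f → H k *N f) oneN β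

  Bhat : Carrier → Carrier → ℕ → NSym
  Bhat a b zero    = oneN
  Bhat a b (suc m) =
    concatMap (λ β → scaleN ((a ^ᴷ (suc m ∸ length β)) * (b ^ᴷ (length β ∸ 1))) (Hc β))
              (comps (suc m))

  -- Sym over K, presented as the commutative polynomial ring K[h_1,h_2,...]
  -- (fundamental theorem of symmetric functions): an element is a finite
  -- K-linear combination of monomials h_{λ}; two are equal iff the
  -- coefficients of every monomial (multiset of letters) agree.

  Sym : Set c
  Sym = List (Carrier × Word)

  coeffS : Sym → Word → Carrier
  coeffS []            w = 0#
  coeffS ((x , u) ∷ f) w with ≡-dec ℕ._≟_ (sort u) (sort w)
  ... | yes _ = x + coeffS f w
  ... | no  _ = coeffS f w

  _≈S_ : Sym → Sym → Set ℓ
  f ≈S g = ∀ w → coeffS f w ≈ coeffS g w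

  oneS : Sym
  oneS = oneN

  _+S_ : Sym → Sym → Sym
  _+S_ = _+N_

  _*S_ : Sym → Sym → Sym
  _*S_ = _*N_

  -- comm : NSym → Sym, the algebra map H_n ↦ h_n (letter k ↦ h_{k+1})
  comm : NSym → Sym
  comm f = f

  -- Subalgebra generated by a family: values of noncommutative
  -- polynomial expressions with coefficients in K in the generators.

  data Expr : Set c where
    gen   : ℕ → Expr
    const : Carrier → Expr
    _⊕_   : Expr → Expr → Expr
    _⊗_   : Expr → Expr → Expr

  evalN : (ℕ → NSym) → Expr → NSym
  evalN g (gen n)   = g n
  evalN g (const x) = scaleN x oneN
  evalN g (e ⊕ e′)  = evalN g e +N evalN g e′
  evalN g (e ⊗ e′)  = evalN g e *N evalN g e′

  evalS : (ℕ → Sym) → Expr → Sym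
  evalS g (gen n)   = g n
  evalS g (const x) = scaleN x oneS
  evalS g (e ⊕ e′)  = evalS g e +S evalS g e′
  evalS g (e ⊗ e′)  = evalS g e *S evalS g e′

  GeneratesNSym : (ℕ → NSym) → Set (c ⊔ ℓ)
  GeneratesNSym g = ∀ (f : NSym) → ∃ λ e → evalN g e ≈N f

  GeneratesSym : (ℕ → Sym) → Set (c ⊔ ℓ)
  GeneratesSym g = ∀ (f : Sym) → ∃ λ e → evalS g e ≈S f

{-# OPTIONS --safe #-}
module Submission where

-- The one-part composition contributes a^m H_{m+1} to B̂(a,b)_{m+1}, and every other
-- composition of m+1 has all its parts ≤ m.  Since a is invertible, H_{m+1} is thus a
-- polynomial in B̂(a,b)_{m+1} and H_1, …, H_m; by induction every H_n, hence every
-- element of NSym, is a polynomial in the B̂(a,b)_n.  The same polynomials work in Sym,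
-- which is presented by the same lists and only has a coarser equality.

open import Defs
open import Level using (Level)
open import Algebra.Bundles using (CommutativeRing)
open import Data.Bool using (Bool; true; false)
open import Data.Product using (_×_; _,_)
open import Data.Nat as ℕ using (ℕ; zero; suc; _∸_; _≤_; _<_; z≤n; s≤s)
open import Data.Nat.Properties using (≤-refl; ≤-trans; m≤n⇒m≤1+n)
open import Data.List using (List; []; _∷_; _++_; _∷ʳ_; [_]; length; map; concatMap)
open import Data.List.Properties using (≡-dec; ++-assoc; ++-identityʳ; concatMap-++; concatMap-pure)
open import Data.List.Relation.Unary.All as All using (All; []; _∷_)
open import Data.List.Relation.Unary.All.Properties using (++⁺; concat⁺; map⁺)
open import Data.List.Sort.InsertionSort Data.Nat.Properties.≤-decTotalOrder using (sort)
open import Relation.Nullary using (¬_; yes; no; does)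
open import Relation.Binary.PropositionalEquality as ≡ using (_≡_)

children : List ℕ → List (List ℕ)
children β = (1 ∷ β) ∷ bump β ∷ []

nontrivialComps : ℕ → List (List ℕ)
nontrivialComps zero    = []
nontrivialComps (suc m) = concatMap children (nontrivialComps m) ∷ʳ (1 ∷ suc m ∷ [])

comps-suc : ∀ m → comps (suc m) ≡ nontrivialComps m ∷ʳ (suc m ∷ [])
comps-suc zero    = ≡.refl
comps-suc (suc m) = begin
  concatMap children (comps (suc m))
    ≡⟨ ≡.cong (concatMap children) (comps-suc m) ⟩
  concatMap children (L ∷ʳ (suc m ∷ []))
    ≡⟨ concatMap-++ children L _ ⟩
  concatMap children L ++ (1 ∷ suc m ∷ []) ∷ (suc (suc m) ∷ []) ∷ []
    ≡⟨ ++-assoc (concatMap children L) _ _ ⟨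
  concatMap children L ∷ʳ (1 ∷ suc m ∷ []) ∷ʳ (suc (suc m) ∷ [])
    ∎
  where
  open ≡.≡-Reasoning
  L = nontrivialComps m

bump-≤ : ∀ {m β} → All (_≤ m) β → All (_≤ suc m) (bump β)
bump-≤ []          = []
bump-≤ (k≤m ∷ β≤m) = s≤s k≤m ∷ All.map m≤n⇒m≤1+n β≤m

children-≤ : ∀ {m β} → All (_≤ m) β → All (All (_≤ suc m)) (children β)
children-≤ β≤m = (s≤s z≤n ∷ All.map m≤n⇒m≤1+n β≤m) ∷ bump-≤ β≤m ∷ []

nontrivialComps-≤ : ∀ m → All (All (_≤ m)) (nontrivialComps m)
nontrivialComps-≤ zero    = []
nontrivialComps-≤ (suc m) =
  ++⁺ (concat⁺ (map⁺ (All.map children-≤ (nontrivialComps-≤ m))))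
      ((s≤s z≤n ∷ ≤-refl ∷ []) ∷ [])

module _ {c ℓ : Level} (K : CommutativeRing c ℓ) where
  open CommutativeRing K
  open import Algebra.Properties.CommutativeSemigroup +-commutativeSemigroup
    using () renaming (interchange to +-interchange)
  open import Algebra.Properties.CommutativeSemigroup *-commutativeSemigroup
    using (x∙yz≈yx∙z) renaming (interchange to *-interchange)
  open import Algebra.Properties.AbelianGroup +-abelianGroup using (xyx⁻¹≈y)
  open import Algebra.Properties.Ring ring using (-1*x≈-x)
  open import Relation.Binary.Reasoning.Setoid setoid

  infixl 7 _⋆_
  _⋆_ : NSym K → NSym K → NSym K
  _⋆_ = _*N_ K

  infixr 8 _^_
  _^_ : Carrier → ℕ → Carrier
  _^_ = _^ᴷ_ K

  ^-inverse : ∀ {x y} → x * y ≈ 1# → ∀ n → x ^ n * y ^ n ≈ 1#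
  ^-inverse xy≈1 zero    = *-identityʳ 1#
  ^-inverse xy≈1 (suc n) =
    trans (*-interchange _ _ _ _) (trans (*-cong xy≈1 (^-inverse xy≈1 n)) (*-identityʳ 1#))

  infixl 8 _when_
  _when_ : Carrier → Bool → Carrier
  x when true  = x
  x when false = 0#

  when-cong : ∀ b {x y} → x ≈ y → x when b ≈ y when b
  when-cong true  x≈y = x≈y
  when-cong false _   = refl

  when-*ˡ : ∀ b x y → (x * y) when b ≈ x * y when b
  when-*ˡ true  x y = refl
  when-*ˡ false x y = sym (zeroʳ x)

  when-swap : ∀ b x y → x * y when b ≈ y * x when b
  when-swap true  x y = *-comm x y
  when-swap false x y = trans (zeroʳ x) (sym (zeroʳ y))

  -- Comparing total coefficients on every set of words P, rather than single
  -- coefficients, makes _*N_ a congruence: a factor only shifts P (coeffOn-∷-⋆, coeffOn-⋆-∷).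
  coeffOn : NSym K → (Word → Bool) → Carrier
  coeffOn []            P = 0#
  coeffOn ((x , u) ∷ f) P = x when P u + coeffOn f P

  infix 4 _≈ᴾ_
  _≈ᴾ_ : NSym K → NSym K → Set ℓ
  f ≈ᴾ g = ∀ P → coeffOn f P ≈ coeffOn g P

  coeffOn-++ : ∀ f g P → coeffOn (f ++ g) P ≈ coeffOn f P + coeffOn g P
  coeffOn-++ []            g P = sym (+-identityˡ _)
  coeffOn-++ ((x , u) ∷ f) g P = trans (+-congˡ (coeffOn-++ f g P)) (sym (+-assoc _ _ _))

  coeffOn-scaleN : ∀ x f P → coeffOn (scaleN K x f) P ≈ x * coeffOn f P
  coeffOn-scaleN x []            P = sym (zeroʳ x)
  coeffOn-scaleN x ((y , v) ∷ f) P =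
    trans (+-cong (when-*ˡ (P v) x y) (coeffOn-scaleN x f P)) (sym (distribˡ x _ _))

  coeffOn-monomial-⋆ : ∀ x u g P →
    coeffOn (((x , u) ∷ []) ⋆ g) P ≈ x * coeffOn g (λ w → P (u ++ w))
  coeffOn-monomial-⋆ x u []            P = sym (zeroʳ x)
  coeffOn-monomial-⋆ x u ((y , v) ∷ g) P =
    trans (+-cong (when-*ˡ (P (u ++ v)) x y) (coeffOn-monomial-⋆ x u g P))
          (sym (distribˡ x _ _))

  coeffOn-∷-⋆ : ∀ x u f g P →
    coeffOn (((x , u) ∷ f) ⋆ g) P ≈ x * coeffOn g (λ w → P (u ++ w)) + coeffOn (f ⋆ g) P
  coeffOn-∷-⋆ x u f g P = begin
    coeffOn (((x , u) ∷ f) ⋆ g) P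
      ≡⟨ ≡.cong (λ h → coeffOn (h ++ f ⋆ g) P) (++-identityʳ (map _ g)) ⟨
    coeffOn ((((x , u) ∷ []) ⋆ g) ++ f ⋆ g) P
      ≈⟨ coeffOn-++ (((x , u) ∷ []) ⋆ g) _ P ⟩
    coeffOn (((x , u) ∷ []) ⋆ g) P + coeffOn (f ⋆ g) P
      ≈⟨ +-congʳ (coeffOn-monomial-⋆ x u g P) ⟩
    x * coeffOn g (λ w → P (u ++ w)) + coeffOn (f ⋆ g) P
      ∎

  coeffOn-⋆-[] : ∀ f P → coeffOn (f ⋆ []) P ≈ 0#
  coeffOn-⋆-[] []            P = refl
  coeffOn-⋆-[] ((x , u) ∷ f) P = coeffOn-⋆-[] f P

  coeffOn-⋆-∷ : ∀ f y v g P →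
    coeffOn (f ⋆ ((y , v) ∷ g)) P ≈ y * coeffOn f (λ w → P (w ++ v)) + coeffOn (f ⋆ g) P
  coeffOn-⋆-∷ []            y v g P = sym (trans (+-identityʳ _) (zeroʳ y))
  coeffOn-⋆-∷ ((x , u) ∷ f) y v g P = begin
    coeffOn (((x , u) ∷ f) ⋆ ((y , v) ∷ g)) P
      ≈⟨ coeffOn-∷-⋆ x u f _ P ⟩
    x * (y when b + G) + coeffOn (f ⋆ ((y , v) ∷ g)) P
      ≈⟨ +-cong (distribˡ x _ _) (coeffOn-⋆-∷ f y v g P) ⟩
    (x * y when b + x * G) + (y * F + R)
      ≈⟨ +-interchange _ _ _ _ ⟩
    (x * y when b + y * F) + (x * G + R)
      ≈⟨ +-cong (trans (+-congʳ (when-swap b x y)) (sym (distribˡ y _ _)))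
                (sym (coeffOn-∷-⋆ x u f g P)) ⟩
    y * (x when b + F) + coeffOn (((x , u) ∷ f) ⋆ g) P
      ∎
    where
    b = P (u ++ v)
    G = coeffOn g (λ w → P (u ++ w))
    F = coeffOn f (λ w → P (w ++ v))
    R = coeffOn (f ⋆ g) P

  ⋆-congˡ : ∀ f {g g′} → g ≈ᴾ g′ → f ⋆ g ≈ᴾ f ⋆ g′
  ⋆-congˡ []            g≈g′ P = refl
  ⋆-congˡ ((x , u) ∷ f) {g} {g′} g≈g′ P =
    trans (coeffOn-∷-⋆ x u f g P)
      (trans (+-cong (*-congˡ (g≈g′ _)) (⋆-congˡ f g≈g′ P)) (sym (coeffOn-∷-⋆ x u f g′ P)))

  ⋆-congʳ : ∀ {f f′} g → f ≈ᴾ f′ → f ⋆ g ≈ᴾ f′ ⋆ g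
  ⋆-congʳ {f} {f′} []            f≈f′ P = trans (coeffOn-⋆-[] f P) (sym (coeffOn-⋆-[] f′ P))
  ⋆-congʳ {f} {f′} ((y , v) ∷ g) f≈f′ P =
    trans (coeffOn-⋆-∷ f y v g P)
      (trans (+-cong (*-congˡ (f≈f′ _)) (⋆-congʳ {f} {f′} g f≈f′ P)) (sym (coeffOn-⋆-∷ f′ y v g P)))

  ⋆-cong : ∀ {f f′ g g′} → f ≈ᴾ f′ → g ≈ᴾ g′ → f ⋆ g ≈ᴾ f′ ⋆ g′
  ⋆-cong {f} {f′} {g} {g′} f≈f′ g≈g′ P = trans (⋆-congʳ {f} {f′} g f≈f′ P) (⋆-congˡ f′ g≈g′ P)

  coeffN-coeffOn : ∀ f w → coeffN K f w ≈ coeffOn f (λ u → does (≡-dec ℕ._≟_ u w))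
  coeffN-coeffOn []            w = refl
  coeffN-coeffOn ((x , u) ∷ f) w with ≡-dec ℕ._≟_ u w
  ... | yes _ = +-congˡ (coeffN-coeffOn f w)
  ... | no  _ = trans (coeffN-coeffOn f w) (sym (+-identityˡ _))

  coeffS-coeffOn : ∀ f w → coeffS K f w ≈ coeffOn f (λ u → does (≡-dec ℕ._≟_ (sort u) (sort w)))
  coeffS-coeffOn []            w = refl
  coeffS-coeffOn ((x , u) ∷ f) w with ≡-dec ℕ._≟_ (sort u) (sort w)
  ... | yes _ = +-congˡ (coeffS-coeffOn f w)
  ... | no  _ = trans (coeffS-coeffOn f w) (sym (+-identityˡ _))

  ≈ᴾ⇒≈N : ∀ {f g} → f ≈ᴾ g → _≈N_ K f g
  ≈ᴾ⇒≈N {f} {g} f≈g w = trans (coeffN-coeffOn f w) (trans (f≈g _) (sym (coeffN-coeffOn g w)))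

  ≈ᴾ⇒≈S : ∀ {f g} → f ≈ᴾ g → _≈S_ K f g
  ≈ᴾ⇒≈S {f} {g} f≈g w = trans (coeffS-coeffOn f w) (trans (f≈g _) (sym (coeffS-coeffOn g w)))

  Hc-letters : ∀ u → Hc K (map suc u) ≈ᴾ (1# , u) ∷ []
  Hc-letters []      P = refl
  Hc-letters (k ∷ u) P =
    trans (coeffOn-monomial-⋆ 1# (k ∷ []) (Hc K (map suc u)) P)
          (trans (*-congˡ (Hc-letters u (λ w → P (k ∷ w)))) (*-identityˡ _))

  module Generation (g : ℕ → NSym K) where

    ev : Expr K → NSym K
    ev = evalN K g

    evalS≡evalN : ∀ e → evalS K g e ≡ ev e
    evalS≡evalN (gen n)   = ≡.refl
    evalS≡evalN (const x) = ≡.refl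
    evalS≡evalN (e ⊕ e′)  = ≡.cong₂ _++_ (evalS≡evalN e) (evalS≡evalN e′)
    evalS≡evalN (e ⊗ e′)  = ≡.cong₂ _⋆_ (evalS≡evalN e) (evalS≡evalN e′)

    eval-const-⊗ : ∀ x e P → coeffOn (ev (const x ⊗ e)) P ≈ x * coeffOn (ev e) P
    eval-const-⊗ x e P = trans (coeffOn-monomial-⋆ (x * 1#) [] (ev e) P) (*-congʳ (*-identityʳ x))

    eval-const-1# : ev (const 1#) ≈ᴾ H K 0
    eval-const-1# P = +-congʳ (when-cong (P []) (*-identityʳ 1#))

    withUnit : (ℕ → Expr K) → ℕ → Expr K
    withUnit e zero    = const 1#
    withUnit e (suc k) = e k

    eval-withUnit : ∀ {e n} → (∀ k → k < n → ev (e k) ≈ᴾ H K (suc k)) →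
                    ∀ p → p ≤ n → ev (withUnit e p) ≈ᴾ H K p
    eval-withUnit e-ok zero    _   = eval-const-1#
    eval-withUnit e-ok (suc k) k<n = e-ok k k<n

    HcExpr : (ℕ → Expr K) → List ℕ → Expr K
    HcExpr ρ []      = const 1#
    HcExpr ρ (p ∷ β) = ρ p ⊗ HcExpr ρ β

    eval-HcExpr : ∀ {ρ β} → All (λ p → ev (ρ p) ≈ᴾ H K p) β → ev (HcExpr ρ β) ≈ᴾ Hc K β
    eval-HcExpr [] = eval-const-1#
    eval-HcExpr {ρ} {p ∷ β} (ρp-ok ∷ ρβ-ok) =
      ⋆-cong {ev (ρ p)} {H K p} {ev (HcExpr ρ β)} {Hc K β} ρp-ok (eval-HcExpr ρβ-ok)

    sumExpr : ∀ {a} {A : Set a} → (A → Expr K) → List A → Expr K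
    sumExpr F []      = const 0#
    sumExpr F (x ∷ L) = F x ⊕ sumExpr F L

    eval-sumExpr : ∀ {a} {A : Set a} {F : A → Expr K} {G : A → NSym K} {L} →
                   All (λ x → ev (F x) ≈ᴾ G x) L → ev (sumExpr F L) ≈ᴾ concatMap G L
    eval-sumExpr [] P = trans (coeffOn-scaleN 0# (oneN K) P) (zeroˡ _)
    eval-sumExpr {F = F} {G} {x ∷ L} (Fx-ok ∷ FL-ok) P =
      trans (coeffOn-++ (ev (F x)) _ P)
        (trans (+-cong (Fx-ok P) (eval-sumExpr FL-ok P)) (sym (coeffOn-++ (G x) _ P)))

    polyExpr : (ℕ → Expr K) → NSym K → Expr K
    polyExpr e = sumExpr λ (x , u) → const x ⊗ HcExpr (withUnit e) (map suc u)

    eval-polyExpr : ∀ e → (∀ k → ev (e k) ≈ᴾ H K (suc k)) → ∀ f → ev (polyExpr e f) ≈ᴾ f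
    eval-polyExpr e e-ok f P =
      trans (eval-sumExpr (All.universal term-ok f) P)
            (reflexive (≡.cong (λ h → coeffOn h P) (concatMap-pure f)))
      where
      letter-ok : ∀ p → ev (withUnit e p) ≈ᴾ H K p
      letter-ok p = eval-withUnit (λ k _ → e-ok k) p ≤-refl

      term-ok : ∀ ((x , u) : Carrier × Word) →
                ev (const x ⊗ HcExpr (withUnit e) (map suc u)) ≈ᴾ [ (x , u) ]
      term-ok (x , u) P = begin
        coeffOn (ev (const x ⊗ HcExpr (withUnit e) (map suc u))) P
          ≈⟨ eval-const-⊗ x (HcExpr (withUnit e) (map suc u)) P ⟩
        x * coeffOn (ev (HcExpr (withUnit e) (map suc u))) P
          ≈⟨ *-congˡ (eval-HcExpr (All.universal letter-ok (map suc u)) P) ⟩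
        x * coeffOn (Hc K (map suc u)) P
          ≈⟨ *-congˡ (Hc-letters u P) ⟩
        x * coeffOn ((1# , u) ∷ []) P
          ≈⟨ coeffOn-scaleN x ((1# , u) ∷ []) P ⟨
        coeffOn ((x * 1# , u) ∷ []) P
          ≈⟨ +-congʳ (when-cong (P u) (*-identityʳ x)) ⟩
        coeffOn ((x , u) ∷ []) P
          ∎

    generates-from-H : ∀ e → (∀ k → ev (e k) ≈ᴾ H K (suc k)) →
                       GeneratesNSym K g × GeneratesSym K g
    generates-from-H e e-ok =
      (λ f → polyExpr e f , ≈ᴾ⇒≈N {ev (polyExpr e f)} {f} (eval-polyExpr e e-ok f)) ,
      (λ f → polyExpr e f ,
         ≡.subst (λ h → _≈S_ K h f) (≡.sym (evalS≡evalN (polyExpr e f)))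
                 (≈ᴾ⇒≈S {ev (polyExpr e f)} {f} (eval-polyExpr e e-ok f)))

  module Triangular (a b a⁻¹ : Carrier) (aa⁻¹≈1 : a * a⁻¹ ≈ 1#) where
    open Generation (Bhat K a b)

    coef : ℕ → List ℕ → Carrier
    coef n β = a ^ (n ∸ length β) * b ^ (length β ∸ 1)

    term : ℕ → List ℕ → NSym K
    term n β = scaleN K (coef n β) (Hc K β)

    coeffOn-Bhat-suc : ∀ m P →
      coeffOn (Bhat K a b (suc m)) P ≈
      coeffOn (concatMap (term (suc m)) (nontrivialComps m)) P + a ^ m * coeffOn (H K (suc m)) P
    coeffOn-Bhat-suc m P = begin
      coeffOn (concatMap T (comps (suc m))) P
        ≡⟨ ≡.cong (λ L → coeffOn (concatMap T L) P) (comps-suc m) ⟩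
      coeffOn (concatMap T (nontrivialComps m ∷ʳ (suc m ∷ []))) P
        ≡⟨ ≡.cong (λ h → coeffOn h P) (concatMap-++ T (nontrivialComps m) _) ⟩
      coeffOn (concatMap T (nontrivialComps m) ++ T (suc m ∷ []) ++ []) P
        ≈⟨ coeffOn-++ (concatMap T (nontrivialComps m)) _ P ⟩
      coeffOn (concatMap T (nontrivialComps m)) P + coeffOn (T (suc m ∷ []) ++ []) P
        ≈⟨ +-congˡ (reflexive (≡.cong (λ h → coeffOn h P) (++-identityʳ (T (suc m ∷ []))))) ⟩
      coeffOn (concatMap T (nontrivialComps m)) P + coeffOn (T (suc m ∷ [])) P
        ≈⟨ +-congˡ (coeffOn-scaleN (coef (suc m) (suc m ∷ [])) (Hc K (suc m ∷ [])) P) ⟩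
      coeffOn (concatMap T (nontrivialComps m)) P + (a ^ m * 1#) * coeffOn (Hc K (suc m ∷ [])) P
        ≈⟨ +-congˡ (*-cong (*-identityʳ _) (+-congʳ (when-cong (P (m ∷ [])) (*-identityʳ 1#)))) ⟩
      coeffOn (concatMap T (nontrivialComps m)) P + a ^ m * coeffOn (H K (suc m)) P
        ∎
      where
      T = term (suc m)

    lowerExpr : (ℕ → Expr K) → ℕ → Expr K
    lowerExpr ρ m = sumExpr (λ β → const (coef (suc m) β) ⊗ HcExpr ρ β) (nontrivialComps m)

    eval-lowerExpr : ∀ {ρ} m → (∀ p → p ≤ m → ev (ρ p) ≈ᴾ H K p) →
                     ev (lowerExpr ρ m) ≈ᴾ concatMap (term (suc m)) (nontrivialComps m)
    eval-lowerExpr {ρ} m ρ-ok = eval-sumExpr (All.map term-ok (nontrivialComps-≤ m))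
      where
      term-ok : ∀ {β} → All (_≤ m) β →
                ev (const (coef (suc m) β) ⊗ HcExpr ρ β) ≈ᴾ term (suc m) β
      term-ok {β} β≤m P =
        trans (eval-const-⊗ _ (HcExpr ρ β) P)
          (trans (*-congˡ (eval-HcExpr (All.map (ρ-ok _) β≤m) P))
                 (sym (coeffOn-scaleN _ (Hc K β) P)))

    next : (ℕ → Expr K) → ℕ → Expr K
    next ρ m = const (a⁻¹ ^ m) ⊗ (gen (suc m) ⊕ (const (- 1#) ⊗ lowerExpr ρ m))

    eval-next : ∀ {ρ} m → (∀ p → p ≤ m → ev (ρ p) ≈ᴾ H K p) → ev (next ρ m) ≈ᴾ H K (suc m)
    eval-next {ρ} m ρ-ok P = begin
      coeffOn (ev (next ρ m)) P
        ≈⟨ eval-const-⊗ (a⁻¹ ^ m) (gen (suc m) ⊕ (const (- 1#) ⊗ lowerExpr ρ m)) P ⟩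
      a⁻¹ ^ m * coeffOn (B ++ ev (const (- 1#) ⊗ lowerExpr ρ m)) P
        ≈⟨ *-congˡ (coeffOn-++ B _ P) ⟩
      a⁻¹ ^ m * (coeffOn B P + coeffOn (ev (const (- 1#) ⊗ lowerExpr ρ m)) P)
        ≈⟨ *-congˡ (+-cong (coeffOn-Bhat-suc m P) (eval-const-⊗ (- 1#) (lowerExpr ρ m) P)) ⟩
      a⁻¹ ^ m * ((R + a ^ m * X) + - 1# * coeffOn (ev (lowerExpr ρ m)) P)
        ≈⟨ *-congˡ (+-congˡ (trans (-1*x≈-x _) (-‿cong (eval-lowerExpr m ρ-ok P)))) ⟩
      a⁻¹ ^ m * ((R + a ^ m * X) - R)
        ≈⟨ *-congˡ (xyx⁻¹≈y R (a ^ m * X)) ⟩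
      a⁻¹ ^ m * (a ^ m * X)
        ≈⟨ x∙yz≈yx∙z (a⁻¹ ^ m) (a ^ m) X ⟩
      (a ^ m * a⁻¹ ^ m) * X
        ≈⟨ *-congʳ (^-inverse aa⁻¹≈1 m) ⟩
      1# * X
        ≈⟨ *-identityˡ X ⟩
      X
        ∎
      where
      B = Bhat K a b (suc m)
      R = coeffOn (concatMap (term (suc m)) (nontrivialComps m)) P
      X = coeffOn (H K (suc m)) P

    HExpr : ℕ → ℕ → Expr K
    HExpr zero    _ = const 0#
    HExpr (suc f)   = next (withUnit (HExpr f))

    eval-HExpr : ∀ f m → m < f → ev (HExpr f m) ≈ᴾ H K (suc m)
    eval-HExpr (suc f) m (s≤s m≤f) =
      eval-next m (eval-withUnit λ k k<m → eval-HExpr f k (≤-trans k<m m≤f))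

    Bhat-generates : GeneratesNSym K (Bhat K a b) × GeneratesSym K (Bhat K a b)
    Bhat-generates = generates-from-H (λ k → HExpr (suc k) k) (λ k → eval-HExpr (suc k) k ≤-refl)

corollary4p11 : {c ℓ : Level} (K : CommutativeRing c ℓ) → IsField K →
    (a b : CommutativeRing.Carrier K) → ¬ (CommutativeRing._≈_ K a (CommutativeRing.0# K)) →
      GeneratesNSym K (Bhat K a b) × GeneratesSym K (λ n → comm K (Bhat K a b n))
corollary4p11 K (_ , inverse) a b a≉0 =
  let a⁻¹ , aa⁻¹≈1 = inverse a a≉0 in Triangular.Bhat-generates K a b a⁻¹ aa⁻¹≈1
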